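{- For integers $k \ge 2$ and $n\ge 2$ with $2k-1\le n$, $$N(CM,k,n)\le\begin{cases} n-k+1 & \text{if } k \text{ is even},\\ (n-k+1)\,\bigl(1+\mathsf{d}(k-1,n)\bigr) & \text{if } k \text{ is odd}.\end{cases}$$
   Context: Majority problem: we are given $n$ balls indexed by $[n]=\{1,\dots,n\}$, each colored by one of two colors by an unknown coloring. A ball $i$ is a majority ball if more than $n/2$ balls (counting $i$) have the same color as $i$. The goal is to either identify a majority ball or correctly conclude that there is none. A query is a $k$-element subset $Q\subseteq[n]$. In the non-adaptive version, a family of queries is fixed in advance; it is successful if for every coloring the answers determine a correct output (a ball that is a majority ball for every coloring consistent with the answers, or the conclusion that no majority ball exists for every coloring consistent with the answers). In the Counting Model (CM), the answer to a query $Q$ is the number $i\le k/2$ such that $Q$ contains exactly $i$ balls of one of the colors (and hence $k-i$ balls of the other color). $N(CM,k,n)$ is the minimum number of queries in a successful non-adaptive query family in this model. A two-coloring of a $k$-set is balanced if the sizes of the two color classes differ by at most one. A hypergraph has Property C if its vertices can be two-colored so that every edge is balanced. For $k\ge 2$, $\mathsf{d}(k,n)$ denotes the minimum number of edges of a $k$-uniform hypergraph on $n$ vertices that does not have Property C. -}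

module Defs where

open import Data.Nat using (ℕ; zero; suc; _+_; _*_; _∸_; _≤_; _<_; _⊓_)
open import Data.Bool using (Bool; true; false; not; _xor_; _∧_; if_then_else_)
open import Data.Fin using (Fin; zero; suc)
open import Data.List using (List; map; length)
open import Data.List.Relation.Unary.All using (All)
open import Data.Product using (Σ; ∃; _×_; _,_)
open import Data.Sum using (_⊎_)
open import Relation.Binary.PropositionalEquality using (_≡_)
open import Relation.Nullary using (¬_)

Coloring : ℕ → Set
Coloring n = Fin n → Bool

SubsetF : ℕ → Set
SubsetF n = Fin n → Bool

count : ∀ {n} → (Fin n → Bool) → ℕ
count {zero}  p = 0
count {suc n} p = (if p zero then 1 else 0) + count {n} (λ i → p (suc i))

size : ∀ {n} → SubsetF n → ℕ
size = count

sameColor : Bool → Bool → Bool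
sameColor a b = not (a xor b)

trueIn : ∀ {n} → Coloring n → SubsetF n → ℕ
trueIn c Q = count (λ j → Q j ∧ c j)

IsMajority : ∀ {n} → Coloring n → Fin n → Set
IsMajority {n} c i = n < 2 * count (λ j → sameColor (c j) (c i))

IsQuery : ∀ {n} → ℕ → SubsetF n → Set
IsQuery k Q = size Q ≡ k

-- Counting-model answer to a k-query Q: the number i ≤ k/2 such that Q contains
-- exactly i balls of one of the colors, i.e. min(#true, #false) within Q.
answerCM : ∀ {n} → Coloring n → SubsetF n → ℕ
answerCM c Q = trueIn c Q ⊓ (size Q ∸ trueIn c Q)

answers : ∀ {n} → List (SubsetF n) → Coloring n → List ℕ
answers F c = map (answerCM c) F

Successful : ∀ {n} → List (SubsetF n) → Set
Successful {n} F =
  (c : Coloring n) →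
    (Σ (Fin n) λ i → (c' : Coloring n) → answers F c' ≡ answers F c → IsMajority c' i)
    ⊎ ((c' : Coloring n) → answers F c' ≡ answers F c → ¬ (Σ (Fin n) λ i → IsMajority c' i))

NCM≤ : ℕ → ℕ → ℕ → Set
NCM≤ k n b = Σ (List (SubsetF n)) λ F → All (IsQuery k) F × Successful F × length F ≤ b

Balanced : ∀ {n} → Coloring n → SubsetF n → Set
Balanced c e = (trueIn c e ∸ (size e ∸ trueIn c e) ≤ 1) × ((size e ∸ trueIn c e) ∸ trueIn c e ≤ 1)

Uniform : ∀ {n} → ℕ → List (SubsetF n) → Set
Uniform k H = All (λ e → size e ≡ k) H

PropertyC : ∀ {n} → List (SubsetF n) → Set
PropertyC {n} H = Σ (Coloring n) λ c → All (Balanced c) H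

IsD : ℕ → ℕ → ℕ → Set
IsD k n d =
  (Σ (List (SubsetF n)) λ H → Uniform k H × ¬ PropertyC H × length H ≡ d)
  × ((H : List (SubsetF n)) → Uniform k H → ¬ PropertyC H → d ≤ length H)

-- For a set A of k − 1 balls, the block of A consists of the n − k + 1 queries A ∪ {j}, j ∉ A.
-- If U and V count the balls of A having j's colour and the other colour, the answer to A ∪ {j}
-- is min(U + 1, V), and it is min(V + 1, U) for a ball of the other colour.
-- If the answers within a block differ, they determine U and V and, up to a global flip, the
-- colours outside A; hence the colour-class size of every ball outside A, in particular of two
-- balls j₁, j₂ of different colours, and a majority ball exists iff j₁ or j₂ is one.
-- If they all agree while A has unequal colour counts, the more than n/2 balls outside A all
-- have one colour.
-- For even k a single block suffices, as U + V = k − 1 is odd. For odd k take the blocks of the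
-- edges of a (k − 1)-uniform hypergraph without Property C together with a set B disjoint from an
-- edge E₀, and a ball z outside E₀ ∪ B. If all blocks agree, some edge E is unbalanced, so the
-- outside of E is monochromatic. Either z has that colour and is a majority ball, or E₀ and B are
-- balanced, and with z they contain k balls of z's colour, all of them inside E: impossible.

module Submission where

open import Defs
open import Data.Nat using (ℕ; zero; suc; _+_; _*_; _∸_; _≤_; _<_; _⊓_; _%_; _/_; z≤n; s≤s; s≤s⁻¹; _<?_; _≤?_)
open import Data.Nat.Properties
open import Data.Nat.DivMod using (m≡m%n+[m/n]*n)
open import Algebra.Properties.CommutativeSemigroup +-commutativeSemigroup using (x∙yz≈y∙xz)
open import Data.Bool using (Bool; true; false; not; _∧_; _∨_; _xor_; if_then_else_)
open import Data.Bool.Properties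
  using (∧-comm; ∧-identityʳ; ∨-identityʳ; ∧-distribʳ-∨; ∨-conicalˡ; ∨-conicalʳ; ∧-conicalˡ; ∧-conicalʳ;
         not-injective; ¬-not; xor-assoc; xor-same; not-distribˡ-xor)
import Data.Bool.Properties as Bool
open import Data.Fin as Fin using (Fin; zero; suc)
import Data.Fin.Properties as Fin
import Data.Vec.Functional as Vector
open import Data.List using (List; []; _∷_; map; length; concatMap)
open import Data.List.Properties using (length-map; length-++; ∷-injective)
open import Data.List.Membership.Propositional using (_∈_; find; lose)
open import Data.List.Membership.Propositional.Properties using (∈-map⁺; ∈-map⁻; ∈-concat⁺′; ∈-concat⁻′)
open import Data.List.Relation.Unary.All as All using (All; []; _∷_)
open import Data.List.Relation.Unary.All.Properties using (¬All⇒Any¬)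
open import Data.List.Relation.Unary.Any using (here; there; any?)
open import Data.Product using (Σ; ∃; ∃₂; _×_; _,_; proj₁; proj₂)
open import Data.Sum using (_⊎_; inj₁; inj₂)
open import Function using (_∘_; id)
open import Relation.Binary.Definitions using (tri<; tri≈; tri>)
open import Relation.Binary.PropositionalEquality
open import Relation.Nullary using (¬_; Dec; does; yes; no; contradiction; _×-dec_; ¬?)
open import Relation.Nullary.Decidable using (decidable-stable)

private variable
  n m q : ℕ
  X Y : Set

-- Counting over Fin n

-- Definitionally the summand of Defs.count, which Data.Bool.toℕ is not.
bit : Bool → ℕ
bit b = if b then 1 else 0

count-cong : {p q : Fin n → Bool} → (∀ i → p i ≡ q i) → count p ≡ count q
count-cong {zero}  eq = refl
count-cong {suc n} eq = cong₂ _+_ (cong bit (eq zero)) (count-cong (eq ∘ suc))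

count-split : (p q : Fin n → Bool) →
  count p ≡ count (λ i → q i ∧ p i) + count (λ i → not (q i) ∧ p i)
count-split {zero}  p q = refl
count-split {suc n} p q with p zero | q zero | count-split (p ∘ suc) (q ∘ suc)
... | false | true  | ih = ih
... | false | false | ih = ih
... | true  | true  | ih = cong suc ih
... | true  | false | ih = trans (cong suc ih) (sym (+-suc _ _))

count-mono : {p q : Fin n → Bool} → (∀ i → p i ≡ true → q i ≡ true) → count p ≤ count q
count-mono {zero}          sub = z≤n
count-mono {suc n} {p} {q} sub with p zero in pz | q zero in qz
... | false | false = count-mono (sub ∘ suc)
... | false | true  = m≤n⇒m≤1+n (count-mono (sub ∘ suc))
... | true  | true  = s≤s (count-mono (sub ∘ suc))
... | true  | false with () ← trans (sym qz) (sub zero pz)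

count-full : count {n} (λ _ → true) ≡ n
count-full {zero}  = refl
count-full {suc n} = cong suc count-full

count<n⇒∃false : (p : Fin n → Bool) → count p < n → ∃ λ j → p j ≡ false
count<n⇒∃false {suc n} p p<n with p zero in pz
... | false = zero , pz
... | true  with j , pj ← count<n⇒∃false (p ∘ suc) (s≤s⁻¹ p<n) = suc j , pj

count-∨-≤ : (p q : Fin n → Bool) → count (λ i → p i ∨ q i) ≤ count p + count q
count-∨-≤ {zero}  p q = z≤n
count-∨-≤ {suc n} p q with p zero | q zero
... | false | false = count-∨-≤ (p ∘ suc) (q ∘ suc)
... | false | true  = ≤-trans (s≤s (count-∨-≤ (p ∘ suc) (q ∘ suc))) (≤-reflexive (sym (+-suc _ _)))
... | true  | b     = s≤s (≤-trans (count-∨-≤ (p ∘ suc) (q ∘ suc)) (+-monoʳ-≤ (count (p ∘ suc)) (m≤n+m _ (bit b))))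

count-∨-disjoint : (p q : Fin n → Bool) → (∀ i → q i ≡ true → p i ≡ false) →
  count (λ i → p i ∨ q i) ≡ count p + count q
count-∨-disjoint {zero}  p q disj = refl
count-∨-disjoint {suc n} p q disj with p zero in pz | q zero in qz
... | false | false = count-∨-disjoint (p ∘ suc) (q ∘ suc) (disj ∘ suc)
... | false | true  = trans (cong suc (count-∨-disjoint (p ∘ suc) (q ∘ suc) (disj ∘ suc))) (sym (+-suc _ _))
... | true  | false = cong suc (count-∨-disjoint (p ∘ suc) (q ∘ suc) (disj ∘ suc))
... | true  | true with () ← trans (sym pz) (disj zero qz)

insert : SubsetF n → Fin n → SubsetF n
insert A j i = A i ∨ does (i Fin.≟ j)

∁ : SubsetF n → SubsetF n
∁ A i = not (A i)

count-insert : (A : SubsetF n) (j : Fin n) (q : Fin n → Bool) → A j ≡ false →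
  count (λ i → insert A j i ∧ q i) ≡ bit (q j) + count (λ i → A i ∧ q i)
count-insert {suc n} A zero q Aj rewrite Aj =
  cong (bit (q zero) +_) (count-cong (λ i → cong (_∧ q (suc i)) (∨-identityʳ (A (suc i)))))
count-insert {suc n} A (suc j) q Aj rewrite ∨-identityʳ (A zero) =
  trans (cong (bit (A zero ∧ q zero) +_) (count-insert (A ∘ suc) j (q ∘ suc) Aj))
        (x∙yz≈y∙xz (bit (A zero ∧ q zero)) (bit (q (suc j))) _)

size-∁ : (A : SubsetF n) → size A + size (∁ A) ≡ n
size-∁ A = sym (trans (sym count-full) (trans (count-split (λ _ → true) A)
  (cong₂ _+_ (count-cong (∧-identityʳ ∘ A)) (count-cong (∧-identityʳ ∘ ∁ A)))))

size-insert : (A : SubsetF n) {j : Fin n} → A j ≡ false → size (insert A j) ≡ suc (size A)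
size-insert A {j} Aj = trans (count-cong (sym ∘ ∧-identityʳ ∘ insert A j))
  (trans (count-insert A j (λ _ → true) Aj) (cong suc (count-cong (∧-identityʳ ∘ A))))

∁-larger : (A : SubsetF n) → size A + size A < n → size A < size (∁ A)
∁-larger A small = +-cancelˡ-< (size A) _ _ (subst (size A + size A <_) (sym (size-∁ A)) small)

outsides-meet : (A A′ : SubsetF n) → size A + size A′ < n → ∃ λ j → A j ≡ false × A′ j ≡ false
outsides-meet A A′ small with j , e ← count<n⇒∃false (λ i → A i ∨ A′ i) (≤-<-trans (count-∨-≤ A A′) small)
  = j , ∨-conicalˡ _ _ e , ∨-conicalʳ _ _ e

subset-of-size : (p : Fin n → Bool) (m : ℕ) → m ≤ count p →
  ∃ λ S → size S ≡ m × (∀ j → S j ≡ true → p j ≡ true)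
subset-of-size {zero}  p zero    _  = (λ ()) , refl , λ ()
subset-of-size {suc n} p m       m≤ with p zero in pz | m
... | true  | suc m′ = let S , sS , S⊆p = subset-of-size (p ∘ suc) m′ (s≤s⁻¹ m≤)
                       in true Vector.∷ S , cong suc sS , λ { zero _ → pz ; (suc j) → S⊆p j }
... | true  | zero   = let S , sS , S⊆p = subset-of-size (p ∘ suc) 0 z≤n
                       in false Vector.∷ S , sS , λ { (suc j) → S⊆p j }
... | false | m′     = let S , sS , S⊆p = subset-of-size (p ∘ suc) m′ m≤
                       in false Vector.∷ S , sS , λ { (suc j) → S⊆p j }

sameColor-refl : ∀ a → sameColor a a ≡ true
sameColor-refl true  = refl
sameColor-refl false = refl

sameColor-true : ∀ a → sameColor a true ≡ a
sameColor-true true  = refl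
sameColor-true false = refl

sameColor-not : ∀ a b → not (sameColor a b) ≡ sameColor a (not b)
sameColor-not true  b = refl
sameColor-not false true  = refl
sameColor-not false false = refl

sameColor-not-self : ∀ a → sameColor a (not a) ≡ false
sameColor-not-self true  = refl
sameColor-not-self false = refl

sameColor-xor : ∀ a b d → sameColor (a xor d) (b xor d) ≡ sameColor a b
sameColor-xor true  true  d     = sameColor-refl (not d)
sameColor-xor false false d     = sameColor-refl d
sameColor-xor true  false true  = refl
sameColor-xor true  false false = refl
sameColor-xor false true  true  = refl
sameColor-xor false true  false = refl

sameColor-sound : ∀ {a b} → sameColor a b ≡ true → a ≡ b
sameColor-sound {true}  {true}  _ = refl
sameColor-sound {false} {false} _ = refl

true≢false-if-separates : (f : Bool → X) {a b : Bool} → f a ≢ f b → f true ≢ f false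
true≢false-if-separates f {true}  {true}  sep = contradiction refl sep
true≢false-if-separates f {true}  {false} sep = sep
true≢false-if-separates f {false} {true}  sep = sep ∘ sym
true≢false-if-separates f {false} {false} sep = contradiction refl sep

injective-if-true≢false : (f : Bool → X) → f true ≢ f false → ∀ {a b} → f a ≡ f b → a ≡ b
injective-if-true≢false f sep {true}  {true}  _  = refl
injective-if-true≢false f sep {true}  {false} eq = contradiction eq sep
injective-if-true≢false f sep {false} {true}  eq = contradiction (sym eq) sep
injective-if-true≢false f sep {false} {false} _  = refl

≗-from-b-and-not-b : (f g : Bool → X) (b : Bool) → f b ≡ g b → f (not b) ≡ g (not b) → ∀ x → f x ≡ g x
≗-from-b-and-not-b f g true  eb enb true  = eb
≗-from-b-and-not-b f g true  eb enb false = enb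
≗-from-b-and-not-b f g false eb enb true  = enb
≗-from-b-and-not-b f g false eb enb false = eb

one-of-two : {a b x : Bool} → a ≢ b → x ≡ a ⊎ x ≡ b
one-of-two {a} {b} {x} a≢b with x Bool.≟ a
... | yes x≡a = inj₁ x≡a
... | no  x≢a = inj₂ (trans (¬-not x≢a) (sym (¬-not (a≢b ∘ sym))))

-- Arithmetic of answers

-- From U + V and the answers min(U + 1, V), min(V + 1, U): the first exceeds the second
-- exactly when U < V, and then U is the second; otherwise U = (U + V) ∸ first.
recover : ℕ → ℕ → ℕ → ℕ
recover s a b with b <? a
... | yes _ = b
... | no  _ = s ∸ a

recover-< : ∀ {s a b} → b < a → recover s a b ≡ b
recover-< {s} {a} {b} b<a with b <? a
... | yes _   = refl
... | no  b≮a = contradiction b<a b≮a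

recover-≮ : ∀ {s a b} → ¬ b < a → recover s a b ≡ s ∸ a
recover-≮ {s} {a} {b} b≮a with b <? a
... | yes b<a = contradiction b<a b≮a
... | no  _   = refl

recover-min-pair : ∀ U V → recover (U + V) (suc U ⊓ V) (suc V ⊓ U) ≡ U
recover-min-pair U V with <-cmp U V
... | tri< U<V _ _ = begin
  recover (U + V) (suc U ⊓ V) (suc V ⊓ U)
    ≡⟨ cong₂ (recover (U + V)) (m≤n⇒m⊓n≡m U<V) (m≥n⇒m⊓n≡n (m≤n⇒m≤1+n (<⇒≤ U<V))) ⟩
  recover (U + V) (suc U) U               ≡⟨ recover-< {U + V} (n<1+n U) ⟩
  U                                       ∎
  where open ≡-Reasoning
... | tri≈ _ refl _ = begin
  recover (U + U) (suc U ⊓ U) (suc U ⊓ U) ≡⟨ cong (λ x → recover (U + U) x x) (m≥n⇒m⊓n≡n (n≤1+n U)) ⟩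
  recover (U + U) U U                     ≡⟨ recover-≮ {U + U} {U} (<-irrefl refl) ⟩
  U + U ∸ U                               ≡⟨ m+n∸n≡m U U ⟩
  U                                       ∎
  where open ≡-Reasoning
... | tri> _ _ V<U = begin
  recover (U + V) (suc U ⊓ V) (suc V ⊓ U)
    ≡⟨ cong₂ (recover (U + V)) (m≥n⇒m⊓n≡n (m≤n⇒m≤1+n (<⇒≤ V<U))) (m≤n⇒m⊓n≡m V<U) ⟩
  recover (U + V) V (suc V)               ≡⟨ recover-≮ {U + V} {V} (<-asym (n<1+n V)) ⟩
  U + V ∸ V                               ≡⟨ m+n∸n≡m U V ⟩
  U                                       ∎
  where open ≡-Reasoning

min-pair-injective : ∀ {U V U′ V′} → U + V ≡ U′ + V′ →
  suc U ⊓ V ≡ suc U′ ⊓ V′ → suc V ⊓ U ≡ suc V′ ⊓ U′ → U ≡ U′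
min-pair-injective {U} {V} {U′} {V′} s a b = begin
  U                                             ≡⟨ recover-min-pair U V ⟨
  recover (U + V) (suc U ⊓ V) (suc V ⊓ U)       ≡⟨ cong₂ (λ x y → recover x y (suc V ⊓ U)) s a ⟩
  recover (U′ + V′) (suc U′ ⊓ V′) (suc V ⊓ U)   ≡⟨ cong (recover (U′ + V′) (suc U′ ⊓ V′)) b ⟩
  recover (U′ + V′) (suc U′ ⊓ V′) (suc V′ ⊓ U′) ≡⟨ recover-min-pair U′ V′ ⟩
  U′                                            ∎
  where open ≡-Reasoning

min-pair-separates : ∀ {U V} → U ≢ V → suc U ⊓ V ≢ suc V ⊓ U
min-pair-separates {U} {V} U≢V a≡b = U≢V (min-pair-injective (+-comm U V) a≡b (sym a≡b))

Close : ℕ → ℕ → Set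
Close a b = a ∸ b ≤ 1 × b ∸ a ≤ 1

close-successor : ∀ {a b} → a < b → b ∸ a ≤ 1 → b ≡ suc a
close-successor {a} {b} a<b b∸a≤1 = begin
  b           ≡⟨ m+[n∸m]≡n (<⇒≤ a<b) ⟨
  a + (b ∸ a) ≡⟨ cong (a +_) (≤-antisym b∸a≤1 (m<n⇒0<n∸m a<b)) ⟩
  a + 1       ≡⟨ +-comm a 1 ⟩
  suc a       ∎
  where open ≡-Reasoning

adjacent-sum : ∀ a → a + suc a ≡ suc (2 * a)
adjacent-sum a = trans (+-suc a a) (cong (λ x → suc (a + x)) (sym (+-identityʳ a)))

close-even⇒equal : ∀ {a b} → Close a b → a + b ≡ 2 * q → a ≡ b
close-even⇒equal {q} {a} {b} (a∸b≤1 , b∸a≤1) sum with <-cmp a b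
... | tri≈ _ a≡b _ = a≡b
... | tri< a<b _ _ = contradiction
  (trans (sym sum) (trans (cong (a +_) (close-successor a<b b∸a≤1)) (adjacent-sum a))) (even≢odd q a)
... | tri> _ _ b<a = contradiction
  (trans (sym sum) (trans (+-comm a b) (trans (cong (b +_) (close-successor b<a a∸b≤1)) (adjacent-sum b)))) (even≢odd q b)

even-half : ∀ k → k % 2 ≡ 0 → k ≡ 2 * (k / 2)
even-half k k%2≡0 = trans (m≡m%n+[m/n]*n k 2) (trans (cong (_+ k / 2 * 2) k%2≡0) (*-comm (k / 2) 2))

odd-half : ∀ k → k % 2 ≡ 1 → k ≡ suc (2 * (k / 2))
odd-half k k%2≡1 = trans (m≡m%n+[m/n]*n k 2) (trans (cong (_+ k / 2 * 2) k%2≡1) (cong suc (*-comm (k / 2) 2)))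

-- Colour counts and answers

colored : Coloring n → SubsetF n → Bool → ℕ
colored c A b = count (λ j → A j ∧ sameColor (c j) b)

colored-split : (c : Coloring n) (A : SubsetF n) (b : Bool) →
  colored c A b + colored c A (not b) ≡ size A
colored-split c A b = sym (trans (count-split A (λ j → sameColor (c j) b))
  (cong₂ _+_ (count-cong (λ j → ∧-comm (sameColor (c j) b) (A j)))
             (count-cong (λ j → trans (∧-comm (not (sameColor (c j) b)) (A j))
                                      (cong (A j ∧_) (sameColor-not (c j) b))))))

trueIn≡colored : (c : Coloring n) (A : SubsetF n) → trueIn c A ≡ colored c A true
trueIn≡colored c A = count-cong (λ j → cong (A j ∧_) (sym (sameColor-true (c j))))

falseIn≡colored : (c : Coloring n) (A : SubsetF n) → size A ∸ trueIn c A ≡ colored c A false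
falseIn≡colored c A = begin
  size A ∸ trueIn c A                                     ≡⟨ cong₂ _∸_ (colored-split c A true) (sym (trueIn≡colored c A)) ⟨
  colored c A true + colored c A false ∸ colored c A true ≡⟨ m+n∸m≡n (colored c A true) _ ⟩
  colored c A false                                       ∎
  where open ≡-Reasoning

answer-colored : (c : Coloring n) (A : SubsetF n) (b : Bool) →
  answerCM c A ≡ colored c A b ⊓ colored c A (not b)
answer-colored c A true  = cong₂ _⊓_ (trueIn≡colored c A) (falseIn≡colored c A)
answer-colored c A false = trans (answer-colored c A true) (⊓-comm _ _)

colored-∪ : (c : Coloring n) (X Y : SubsetF n) (b : Bool) → (∀ {j} → Y j ≡ true → X j ≡ false) →
  colored c (λ j → X j ∨ Y j) b ≡ colored c X b + colored c Y b
colored-∪ c X Y b disjoint = trans (count-cong (λ j → ∧-distribʳ-∨ (sameColor (c j) b) (X j) (Y j)))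
  (count-∨-disjoint (λ j → X j ∧ sameColor (c j) b) (λ j → Y j ∧ sameColor (c j) b)
    (λ j e → cong (_∧ sameColor (c j) b) (disjoint (∧-conicalˡ _ _ e))))

addBall : (Bool → ℕ) → Bool → ℕ
addBall u b = suc (u b) ⊓ u (not b)

colored-insert-self : (c : Coloring n) (A : SubsetF n) {j : Fin n} → A j ≡ false →
  colored c (insert A j) (c j) ≡ suc (colored c A (c j))
colored-insert-self c A {j} Aj = trans (count-insert A j (λ i → sameColor (c i) (c j)) Aj)
  (cong (λ b → bit b + colored c A (c j)) (sameColor-refl (c j)))

colored-insert-other : (c : Coloring n) (A : SubsetF n) {j : Fin n} → A j ≡ false →
  colored c (insert A j) (not (c j)) ≡ colored c A (not (c j))
colored-insert-other c A {j} Aj = trans (count-insert A j (λ i → sameColor (c i) (not (c j))) Aj)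
  (cong (λ b → bit b + colored c A (not (c j))) (sameColor-not-self (c j)))

answer-insert : (c : Coloring n) (A : SubsetF n) {j : Fin n} → A j ≡ false →
  answerCM c (insert A j) ≡ addBall (colored c A) (c j)
answer-insert c A {j} Aj = trans (answer-colored c (insert A j) (c j))
  (cong₂ _⊓_ (colored-insert-self c A Aj) (colored-insert-other c A Aj))

addBall-determines : (u u′ : Bool → ℕ) → u true + u false ≡ u′ true + u′ false →
  (∀ b → addBall u′ b ≡ addBall u b) → ∀ b → u′ b ≡ u b
addBall-determines u u′ s same true  = sym (min-pair-injective s (sym (same true)) (sym (same false)))
addBall-determines u u′ s same false =
  sym (min-pair-injective (trans (+-comm (u false) _) (trans s (+-comm (u′ true) _))) (sym (same false)) (sym (same true)))

twice-if-equal : (c : Coloring n) (A : SubsetF n) → colored c A true ≡ colored c A false →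
  2 * colored c A true ≡ size A
twice-if-equal c A T≡F = trans (cong (colored c A true +_) (trans (+-identityʳ _) T≡F)) (colored-split c A true)

balanced≡close : (c : Coloring n) (A : SubsetF n) → Balanced c A ≡ Close (colored c A true) (colored c A false)
balanced≡close c A = cong₂ Close (trueIn≡colored c A) (falseIn≡colored c A)

balanced? : (c : Coloring n) (A : SubsetF n) → Dec (Balanced c A)
balanced? c A = (_ ≤? 1) ×-dec (_ ≤? 1)

balanced-if-equal : (c : Coloring n) (A : SubsetF n) → colored c A true ≡ colored c A false → Balanced c A
balanced-if-equal c A T≡F =
  subst id (sym (balanced≡close c A)) (subst (Close (colored c A true)) T≡F (close-refl , close-refl))
  where
  close-refl : colored c A true ∸ colored c A true ≤ 1
  close-refl = subst (_≤ 1) (sym (n∸n≡0 (colored c A true))) z≤n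

balanced-half : (c : Coloring n) (A : SubsetF n) → Balanced c A → size A ≡ 2 * q → ∀ b → colored c A b ≡ q
balanced-half {q = q} c A bal sA = half
  where
  T≡F : colored c A true ≡ colored c A false
  T≡F = close-even⇒equal {q = q} (subst id (balanced≡close c A) bal) (trans (colored-split c A true) sA)
  half : ∀ b → colored c A b ≡ q
  half true  = *-cancelˡ-≡ (colored c A true) q 2 (trans (twice-if-equal c A T≡F) sA)
  half false = trans (sym T≡F) (half true)

classSize : Coloring n → Fin n → ℕ
classSize c i = count (λ j → sameColor (c j) (c i))

classSize-cong : (c : Coloring n) {i j : Fin n} → c i ≡ c j → classSize c i ≡ classSize c j
classSize-cong c e = cong (λ b → count (λ x → sameColor (c x) b)) e

classSize-split : (c : Coloring n) (A : SubsetF n) (i : Fin n) →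
  classSize c i ≡ colored c A (c i) + count (λ j → ∁ A j ∧ sameColor (c j) (c i))
classSize-split c A i = count-split (λ j → sameColor (c j) (c i)) A

colored-≤-classSize : (c : Coloring n) (A : SubsetF n) (i : Fin n) → colored c A (c i) ≤ classSize c i
colored-≤-classSize c A i = count-mono {p = λ j → A j ∧ sameColor (c j) (c i)} (λ j → ∧-conicalʳ _ _)

classSize-≤-size : (c : Coloring n) (E : SubsetF n) {z : Fin n} →
  (∀ {j} → E j ≡ false → c j ≢ c z) → classSize c z ≤ size E
classSize-≤-size c E {z} other = count-mono inside
  where
  inside : ∀ j → sameColor (c j) (c z) ≡ true → E j ≡ true
  inside j same with E j in Ej
  ... | true  = refl
  ... | false = contradiction (sameColor-sound same) (other Ej)

majority-of-outside : (c : Coloring n) (A : SubsetF n) {w : Fin n} → size A + size A < n →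
  (∀ {j} → A j ≡ false → c j ≡ c w) → IsMajority c w
majority-of-outside {n} c A {w} small outside = begin-strict
  n                             ≡⟨ size-∁ A ⟨
  size A + size (∁ A)           <⟨ +-monoˡ-< (size (∁ A)) A<∁A ⟩
  size (∁ A) + size (∁ A)       ≤⟨ +-mono-≤ ∁A≤class ∁A≤class ⟩
  classSize c w + classSize c w ≡⟨ cong (classSize c w +_) (+-identityʳ (classSize c w)) ⟨
  2 * classSize c w             ∎
  where
  open ≤-Reasoning
  A<∁A : size A < size (∁ A)
  A<∁A = ∁-larger A small
  ∁A≤class : size (∁ A) ≤ classSize c w
  ∁A≤class = count-mono {p = ∁ A} {q = λ j → sameColor (c j) (c w)} λ j ∁Aj →
    trans (cong (λ b → sameColor b (c w)) (outside (not-injective ∁Aj))) (sameColor-refl (c w))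

-- Blocks

Constant : Coloring n → SubsetF n → Set
Constant c A = ∀ {j₁ j₂} → A j₁ ≡ false → A j₂ ≡ false → answerCM c (insert A j₁) ≡ answerCM c (insert A j₂)

NonConstant : Coloring n → SubsetF n → Set
NonConstant c A = ∃₂ λ j₁ j₂ →
  A j₁ ≡ false × A j₂ ≡ false × answerCM c (insert A j₁) ≢ answerCM c (insert A j₂)

nonConstant? : (c : Coloring n) (A : SubsetF n) → Dec (NonConstant c A)
nonConstant? c A = Fin.any? λ j₁ → Fin.any? λ j₂ →
  (A j₁ Bool.≟ false) ×-dec (A j₂ Bool.≟ false) ×-dec ¬? (answerCM c (insert A j₁) ≟ answerCM c (insert A j₂))

¬nonConstant⇒constant : (c : Coloring n) (A : SubsetF n) → ¬ NonConstant c A → Constant c A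
¬nonConstant⇒constant c A ¬nc {j₁} {j₂} A₁ A₂ with answerCM c (insert A j₁) ≟ answerCM c (insert A j₂)
... | yes same = same
... | no  diff = contradiction (j₁ , j₂ , A₁ , A₂ , diff) ¬nc

AgreeOn : Coloring n → Coloring n → SubsetF n → Set
AgreeOn c c′ A = ∀ {j} → A j ≡ false → answerCM c′ (insert A j) ≡ answerCM c (insert A j)

constant-transfer : {c c′ : Coloring n} {A : SubsetF n} → Constant c A → AgreeOn c c′ A → Constant c′ A
constant-transfer const agree A₁ A₂ = trans (agree A₁) (trans (const A₁ A₂) (sym (agree A₂)))

-- A consistent c′ agrees with c outside A up to the flip δ (recolored), and so do the colour
-- counts inside A (recounted); hence the colour classes of balls outside A keep their size.
module NonConstantBlock (c c′ : Coloring n) (A : SubsetF n) {j₁ j₂ : Fin n}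
         (A₁ : A j₁ ≡ false) (A₂ : A j₂ ≡ false)
         (split : answerCM c (insert A j₁) ≢ answerCM c (insert A j₂))
         (agree : AgreeOn c c′ A) where

  private
    u u′ : Bool → ℕ
    u  = colored c A
    u′ = colored c′ A

    same-answer : ∀ {j} → A j ≡ false → addBall u′ (c′ j) ≡ addBall u (c j)
    same-answer Aj = trans (sym (answer-insert c′ A Aj)) (trans (agree Aj) (answer-insert c A Aj))

    split-u : addBall u (c j₁) ≢ addBall u (c j₂)
    split-u e = split (trans (answer-insert c A A₁) (trans e (sym (answer-insert c A A₂))))

    split-u′ : addBall u′ (c′ j₁) ≢ addBall u′ (c′ j₂)
    split-u′ e = split-u (trans (sym (same-answer A₁)) (trans e (same-answer A₂)))

  separated : c′ j₁ ≢ c′ j₂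
  separated e = split-u′ (cong (addBall u′) e)

  private
    δ : Bool
    δ = c j₁ xor c′ j₁

    shift-j₁ : c j₁ xor δ ≡ c′ j₁
    shift-j₁ = trans (sym (xor-assoc (c j₁) (c j₁) (c′ j₁))) (cong (_xor c′ j₁) (xor-same (c j₁)))

    shift-j₂ : not (c j₁) xor δ ≡ c′ j₂
    shift-j₂ = trans (sym (not-distribˡ-xor (c j₁) δ)) (trans (cong not shift-j₁) (sym (¬-not (separated ∘ sym))))

    c-j₂ : c j₂ ≡ not (c j₁)
    c-j₂ = ¬-not λ e → split-u (cong (addBall u) (sym e))

    shifted : ∀ b → addBall u′ (b xor δ) ≡ addBall u b
    shifted = ≗-from-b-and-not-b (λ b → addBall u′ (b xor δ)) (addBall u) (c j₁)
      (trans (cong (addBall u′) shift-j₁) (same-answer A₁))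
      (trans (cong (addBall u′) shift-j₂) (trans (same-answer A₂) (cong (addBall u) c-j₂)))

    recolored : ∀ {j} → A j ≡ false → c′ j ≡ c j xor δ
    recolored {j} Aj = injective-if-true≢false (addBall u′) (true≢false-if-separates (addBall u′) split-u′)
      (trans (same-answer Aj) (sym (shifted (c j))))

    recounted : ∀ b → u′ (b xor δ) ≡ u b
    recounted = addBall-determines u (λ b → u′ (b xor δ)) sums
      (λ b → trans (cong (λ x → suc (u′ (b xor δ)) ⊓ u′ x) (sym (not-distribˡ-xor b δ))) (shifted b))
      where
      sums : u true + u false ≡ u′ (true xor δ) + u′ (false xor δ)
      sums = trans (colored-split c A true)
        (sym (trans (cong (λ x → u′ (true xor δ) + u′ x) (sym (not-distribˡ-xor true δ)))
                    (colored-split c′ A (true xor δ))))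

  classSize-preserved : ∀ {i} → A i ≡ false → classSize c′ i ≡ classSize c i
  classSize-preserved {i} Ai = begin
    classSize c′ i                                            ≡⟨ classSize-split c′ A i ⟩
    u′ (c′ i) + count (λ j → ∁ A j ∧ sameColor (c′ j) (c′ i)) ≡⟨ cong₂ _+_ inside (count-cong outside) ⟩
    u (c i) + count (λ j → ∁ A j ∧ sameColor (c j) (c i))     ≡⟨ classSize-split c A i ⟨
    classSize c i                                             ∎
    where
    open ≡-Reasoning
    inside : u′ (c′ i) ≡ u (c i)
    inside = trans (cong u′ (recolored Ai)) (recounted (c i))
    outside : ∀ j → ∁ A j ∧ sameColor (c′ j) (c′ i) ≡ ∁ A j ∧ sameColor (c j) (c i)
    outside j with A j in Aj
    ... | true  = refl
    ... | false = trans (cong₂ sameColor (recolored Aj) (recolored Ai)) (sameColor-xor (c j) (c i) δ)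

OutsideMonochrome : Coloring n → SubsetF n → Set
OutsideMonochrome c A = ∀ {i j} → A i ≡ false → A j ≡ false → c i ≡ c j

constant-monochrome : (c : Coloring n) (A : SubsetF n) → Constant c A →
  colored c A true ≢ colored c A false → OutsideMonochrome c A
constant-monochrome c A const T≢F Ai Aj =
  injective-if-true≢false (addBall (colored c A)) (min-pair-separates T≢F)
    (trans (sym (answer-insert c A Ai)) (trans (const Ai Aj) (answer-insert c A Aj)))

unbalanced-monochrome : (c : Coloring n) (A : SubsetF n) → Constant c A → ¬ Balanced c A → OutsideMonochrome c A
unbalanced-monochrome c A const ¬bal = constant-monochrome c A const (¬bal ∘ balanced-if-equal c A)

odd-constant-majority : (c : Coloring n) (A : SubsetF n) {w : Fin n} → suc (size A) ≡ 2 * q →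
  size A + size A < n → Constant c A → A w ≡ false → IsMajority c w
odd-constant-majority {q = q} c A sA small const Aw =
  majority-of-outside c A small λ Aj → constant-monochrome c A const T≢F Aj Aw
  where
  T≢F : colored c A true ≢ colored c A false
  T≢F T≡F = even≢odd q (colored c A true) (sym (trans (cong suc (twice-if-equal c A T≡F)) sA))

-- If z's colour differs from that of the outside of E, the outsides of E₀ and B cannot be
-- monochromatic (they would meet the outside of E), so both are balanced; with z they give
-- 2q + 1 balls of z's colour, all of which lie in E.
majority-beside-halves : (c : Coloring n) (E₀ B E : SubsetF n) {z : Fin n} →
  size E₀ ≡ 2 * q → size B ≡ 2 * q → size E ≡ 2 * q → 2 * q + 2 * q < n →
  (∀ {j} → B j ≡ true → E₀ j ≡ false) → E₀ z ≡ false → B z ≡ false →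
  Constant c E₀ → Constant c B → Constant c E → ¬ Balanced c E → IsMajority c z
majority-beside-halves {n} {q} c E₀ B E {z} sE₀ sB sE small disjoint E₀z Bz const₀ constB constE ¬balE =
  decide (c z Bool.≟ c w)
  where
  pair-small : ∀ {X Y : SubsetF n} → size X ≡ 2 * q → size Y ≡ 2 * q → size X + size Y < n
  pair-small sX sY = subst₂ (λ a b → a + b < n) (sym sX) (sym sY) small

  outside-E : ∃ λ w → E w ≡ false
  outside-E = count<n⇒∃false E (≤-<-trans (m≤m+n (size E) (size E)) (pair-small sE sE))
  w : Fin n
  w = proj₁ outside-E
  Ew : E w ≡ false
  Ew = proj₂ outside-E

  monoE : OutsideMonochrome c E
  monoE = unbalanced-monochrome c E constE ¬balE

  balanced-through-z : c z ≢ c w → (X : SubsetF n) → size X ≡ 2 * q → Constant c X → X z ≡ false →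
    Balanced c X
  balanced-through-z z≢w X sX constX Xz = decidable-stable (balanced? c X) λ ¬balX →
    let j , Xj , Ej = outsides-meet X E (pair-small sX sE)
    in z≢w (trans (unbalanced-monochrome c X constX ¬balX Xz Xj) (monoE Ej Ew))

  too-many : c z ≢ c w → suc (2 * q) ≤ 2 * q
  too-many z≢w = begin
    suc (2 * q)                                   ≡⟨ cong (λ x → suc (q + x)) (+-identityʳ q) ⟩
    suc (q + q)                                   ≡⟨ cong suc (cong₂ _+_ (half E₀ sE₀ const₀ E₀z) (half B sB constB Bz)) ⟨
    suc (colored c E₀ (c z) + colored c B (c z))  ≡⟨ cong suc (colored-∪ c E₀ B (c z) disjoint) ⟨
    suc (colored c (λ j → E₀ j ∨ B j) (c z))      ≡⟨ colored-insert-self c (λ j → E₀ j ∨ B j) (cong₂ _∨_ E₀z Bz) ⟨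
    colored c (insert (λ j → E₀ j ∨ B j) z) (c z) ≤⟨ colored-≤-classSize c _ z ⟩
    classSize c z                                 ≤⟨ classSize-≤-size c E (λ Ej j≡z → z≢w (trans (sym j≡z) (monoE Ej Ew))) ⟩
    size E                                        ≡⟨ sE ⟩
    2 * q                                         ∎
    where
    open ≤-Reasoning
    half : (X : SubsetF n) → size X ≡ 2 * q → Constant c X → X z ≡ false → colored c X (c z) ≡ q
    half X sX constX Xz = balanced-half c X (balanced-through-z z≢w X sX constX Xz) sX (c z)

  decide : Dec (c z ≡ c w) → IsMajority c z
  decide (yes z≡w) = majority-of-outside c E (pair-small sE sE) λ Ej → trans (monoE Ej Ew) (sym z≡w)
  decide (no  z≢w) = contradiction (too-many z≢w) 1+n≰n

-- The query family

elements : (Fin n → Bool) → List (Fin n)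
elements {zero}  p = []
elements {suc n} p with p zero
... | true  = zero ∷ map suc (elements (p ∘ suc))
... | false = map suc (elements (p ∘ suc))

length-elements : (p : Fin n → Bool) → length (elements p) ≡ count p
length-elements {zero}  p = refl
length-elements {suc n} p with p zero
... | true  = cong suc (trans (length-map Fin.suc (elements (p ∘ suc))) (length-elements (p ∘ suc)))
... | false = trans (length-map Fin.suc (elements (p ∘ suc))) (length-elements (p ∘ suc))

∈-elements⁺ : (p : Fin n → Bool) {j : Fin n} → p j ≡ true → j ∈ elements p
∈-elements⁺ {suc n} p {j} pj with p zero in pz | j
... | true  | zero  = here refl
... | true  | suc j = there (∈-map⁺ suc (∈-elements⁺ (p ∘ suc) pj))
... | false | suc j = ∈-map⁺ suc (∈-elements⁺ (p ∘ suc) pj)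
... | false | zero  with () ← trans (sym pz) pj

∈-elements⁻ : (p : Fin n → Bool) {j : Fin n} → j ∈ elements p → p j ≡ true
∈-elements⁻ {suc n} p j∈ with p zero in pz
... | true  with j∈
...   | here refl = pz
...   | there j∈′ with i , i∈ , refl ← ∈-map⁻ suc j∈′ = ∈-elements⁻ (p ∘ suc) i∈
∈-elements⁻ {suc n} p j∈ | false with i , i∈ , refl ← ∈-map⁻ suc j∈ = ∈-elements⁻ (p ∘ suc) i∈

block : SubsetF n → List (SubsetF n)
block A = map (insert A) (elements (∁ A))

family : List (SubsetF n) → List (SubsetF n)
family = concatMap block

∈-family⁺ : {L : List (SubsetF n)} {A : SubsetF n} {j : Fin n} →
  A ∈ L → A j ≡ false → insert A j ∈ family L
∈-family⁺ {A = A} A∈L Aj =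
  ∈-concat⁺′ (∈-map⁺ (insert A) (∈-elements⁺ (∁ A) (cong not Aj))) (∈-map⁺ block A∈L)

∈-family⁻ : {L : List (SubsetF n)} {Q : SubsetF n} → Q ∈ family L →
  ∃ λ A → A ∈ L × ∃ λ j → A j ≡ false × Q ≡ insert A j
∈-family⁻ {L = L} Q∈
  with _ , Q∈B , B∈ ← ∈-concat⁻′ (map block L) Q∈
  with A , A∈L , refl ← ∈-map⁻ block B∈
  with j , j∈ , refl ← ∈-map⁻ (insert A) Q∈B
  = A , A∈L , j , not-injective (∈-elements⁻ (∁ A) j∈) , refl

length-block : (A : SubsetF n) → length (block A) ≡ n ∸ size A
length-block {n} A = begin
  length (block A)             ≡⟨ length-map (insert A) (elements (∁ A)) ⟩
  length (elements (∁ A))      ≡⟨ length-elements (∁ A) ⟩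
  size (∁ A)                   ≡⟨ m+n∸m≡n (size A) (size (∁ A)) ⟨
  size A + size (∁ A) ∸ size A ≡⟨ cong (_∸ size A) (size-∁ A) ⟩
  n ∸ size A                   ∎
  where open ≡-Reasoning

length-family : {L : List (SubsetF n)} → All (λ A → size A ≡ m) L →
  length (family L) ≡ length L * (n ∸ m)
length-family [] = refl
length-family {n} {L = A ∷ L} (refl ∷ sizes) =
  trans (length-++ (block A)) (cong₂ _+_ (length-block A) (length-family sizes))

queries-family : {L : List (SubsetF n)} → All (λ A → size A ≡ m) L →
  All (IsQuery (suc m)) (family L)
queries-family sizes = All.tabulate λ Q∈ →
  let A , A∈L , j , Aj , Q≡ = ∈-family⁻ Q∈
  in trans (cong size Q≡) (trans (size-insert A Aj) (cong suc (All.lookup sizes A∈L)))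

map-pointwise : (f g : X → Y) {xs : List X} {x : X} → map f xs ≡ map g xs → x ∈ xs → f x ≡ g x
map-pointwise f g {_ ∷ _} eq (here refl) = proj₁ (∷-injective eq)
map-pointwise f g {_ ∷ _} eq (there x∈) = map-pointwise f g (proj₂ (∷-injective eq)) x∈

answers-agree : {L : List (SubsetF n)} {c c′ : Coloring n} {A : SubsetF n} →
  answers (family L) c′ ≡ answers (family L) c → A ∈ L → AgreeOn c c′ A
answers-agree {c = c} {c′} same A∈L Aj = map-pointwise (answerCM c′) (answerCM c) same (∈-family⁺ A∈L Aj)

decided-by-two : (c : Coloring n) (Consistent : Coloring n → Set) {j₁ j₂ : Fin n} →
  (∀ {c′} → Consistent c′ →
     c′ j₁ ≢ c′ j₂ × classSize c′ j₁ ≡ classSize c j₁ × classSize c′ j₂ ≡ classSize c j₂) →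
  (Σ (Fin n) λ i → ∀ c′ → Consistent c′ → IsMajority c′ i)
    ⊎ (∀ c′ → Consistent c′ → ¬ Σ (Fin n) (IsMajority c′))
decided-by-two {n} c Consistent {j₁} {j₂} two
  with n <? 2 * classSize c j₁ | n <? 2 * classSize c j₂
... | yes maj₁ | _        = inj₁ (j₁ , λ c′ cons → let _ , s₁ , _ = two cons in subst (λ s → n < 2 * s) (sym s₁) maj₁)
... | no  _    | yes maj₂ = inj₁ (j₂ , λ c′ cons → let _ , _ , s₂ = two cons in subst (λ s → n < 2 * s) (sym s₂) maj₂)
... | no ¬maj₁ | no ¬maj₂ = inj₂ none
  where
  none : ∀ c′ → Consistent c′ → ¬ Σ (Fin n) (IsMajority c′)
  none c′ cons (i , maj) with sep , s₁ , s₂ ← two cons with one-of-two {x = c′ i} sep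
  ... | inj₁ e = ¬maj₁ (subst (λ s → n < 2 * s) (trans (classSize-cong c′ e) s₁) maj)
  ... | inj₂ e = ¬maj₂ (subst (λ s → n < 2 * s) (trans (classSize-cong c′ e) s₂) maj)

family-successful : (L : List (SubsetF n)) (z : Fin n) →
  (∀ c → (∀ {A} → A ∈ L → Constant c A) → IsMajority c z) → Successful (family L)
family-successful L z majority c with any? (nonConstant? c) L
... | no none = inj₁ (z , λ c′ same → majority c′ λ {A} A∈L →
        constant-transfer {c = c} {c′} {A} (¬nonConstant⇒constant c A (none ∘ lose A∈L)) (answers-agree same A∈L))
... | yes some with A , A∈L , j₁ , j₂ , A₁ , A₂ , split ← find some =
  decided-by-two c _ λ same →
    let open NonConstantBlock c _ A A₁ A₂ split (answers-agree same A∈L)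
    in separated , classSize-preserved A₁ , classSize-preserved A₂

family-NCM≤ : (L : List (SubsetF n)) → All (λ A → size A ≡ m) L → (z : Fin n) →
  (∀ c → (∀ {A} → A ∈ L → Constant c A) → IsMajority c z) → NCM≤ (suc m) n (length L * (n ∸ m))
family-NCM≤ L sizes z majority =
  family L , queries-family sizes , family-successful L z majority , ≤-reflexive (length-family sizes)

-- The two constructions

NCM≤-even : suc m ≡ 2 * q → m + m < n → NCM≤ (suc m) n (n ∸ m)
NCM≤-even {m} {q} {n} k≡2q small
  with A , sA , _ ← subset-of-size (λ _ → true) m (subst (m ≤_) (sym count-full) (≤-trans (m≤m+n m m) (<⇒≤ small)))
  = subst (NCM≤ (suc m) n) (+-identityʳ (n ∸ m)) (family-NCM≤ (A ∷ []) (sA ∷ []) w λ c const →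
      odd-constant-majority {q = q} c A (trans (cong suc sA) k≡2q) small′ (const (here refl)) Aw)
  where
  small′ : size A + size A < n
  small′ = subst (λ s → s + s < n) (sym sA) small
  outside-A : ∃ λ w → A w ≡ false
  outside-A = count<n⇒∃false A (≤-<-trans (m≤m+n (size A) (size A)) small′)
  w : Fin n
  w = proj₁ outside-A
  Aw : A w ≡ false
  Aw = proj₂ outside-A

NCM≤-odd : m ≡ 2 * q → m + m < n → (H : List (SubsetF n)) → Uniform m H → ¬ PropertyC H →
  NCM≤ (suc m) n (suc (length H) * (n ∸ m))
NCM≤-odd _ _ [] _ ¬C = contradiction ((λ _ → true) , []) ¬C
NCM≤-odd {q = q} {n} m≡2q small (E₀ ∷ H) uniform@(refl ∷ _) ¬C
  with B , sB , B⊆∁E₀ ← subset-of-size (∁ E₀) (size E₀) (<⇒≤ (∁-larger E₀ small))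
  with z , E₀z , Bz ← outsides-meet E₀ B (subst (λ b → size E₀ + b < n) (sym sB) small)
  = family-NCM≤ (B ∷ E₀ ∷ H) (sB ∷ uniform) z majority
  where
  q-sized : ∀ {X : SubsetF n} → size X ≡ size E₀ → size X ≡ 2 * q
  q-sized sX = trans sX m≡2q
  majority : ∀ c → (∀ {A} → A ∈ (B ∷ E₀ ∷ H) → Constant c A) → IsMajority c z
  majority c const with E , E∈ , ¬balE ← find (¬All⇒Any¬ (balanced? c) (E₀ ∷ H) (¬C ∘ (c ,_))) =
    majority-beside-halves {q = q} c E₀ B E m≡2q (q-sized sB) (q-sized (All.lookup uniform E∈))
      (subst (λ s → s + s < n) m≡2q small) (not-injective ∘ B⊆∁E₀ _) E₀z Bz
      (const (there (here refl))) (const (here refl)) (const (there E∈)) ¬balE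

theorem6 : (k n : ℕ) → 2 ≤ k → 2 ≤ n → 2 * k ∸ 1 ≤ n →
    (k % 2 ≡ 0 → NCM≤ k n (n ∸ k + 1))
    × (k % 2 ≡ 1 → (d : ℕ) → IsD (k ∸ 1) n d → NCM≤ k n ((n ∸ k + 1) * (1 + d)))
theorem6 (suc m) n (s≤s _) _ 2k-1≤n = even , odd
  where
  small : m + m < n
  small = subst (_≤ n) (trans (+-suc m (m + 0)) (cong (λ x → suc (m + x)) (+-identityʳ m))) 2k-1≤n
  width : n ∸ m ≡ n ∸ suc m + 1
  width = trans (cong (_∸ suc m) (+-comm 1 n)) (+-∸-comm 1 (≤-<-trans (m≤m+n m m) small))
  even : suc m % 2 ≡ 0 → NCM≤ (suc m) n (n ∸ suc m + 1)
  even k%2≡0 = subst (NCM≤ (suc m) n) width (NCM≤-even {q = suc m / 2} (even-half (suc m) k%2≡0) small)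
  odd : suc m % 2 ≡ 1 → (d : ℕ) → IsD m n d → NCM≤ (suc m) n ((n ∸ suc m + 1) * (1 + d))
  odd k%2≡1 d ((H , uniform , ¬C , refl) , _) =
    subst (NCM≤ (suc m) n) (trans (*-comm (suc (length H)) (n ∸ m)) (cong (_* suc (length H)) width))
      (NCM≤-odd {q = suc m / 2} (suc-injective (odd-half (suc m) k%2≡1)) small H uniform ¬C)
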